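{- The classes $\mathbb{Z}_\infty^+$ and $\mathbb{Z}_\infty^-$ are each closed under Surinteger addition: if $a,b\in\mathbb{Z}_\infty^+$ then $a+b\in\mathbb{Z}_\infty^+$, and if $a,b\in\mathbb{Z}_\infty^-$ then $a+b\in\mathbb{Z}_\infty^-$.
   Context: $\mathbb{Z}_\infty$ is the class of pairs $(\alpha,\beta)$ of ordinals whose Cantor normal forms share no exponent, identified with finite formal sums $\sum_\zeta\omega^\zeta c_\zeta$ with $c_\zeta\in\mathbb{Z}$, where $c_\zeta$ is the coefficient of $\omega^\zeta$ in $\beta$ if it occurs there, minus its coefficient in $\alpha$ if it occurs there, and $0$ otherwise. Surinteger addition is coefficientwise addition of these formal sums. For a pair $a$, $1^{st}a,2^{nd}a$ are its coordinates; $\mathbb{Z}_\infty^+=\{a\in\mathbb{Z}_\infty:1^{st}a\le 2^{nd}a\}$ and $\mathbb{Z}_\infty^-=\{a\in\mathbb{Z}_\infty:2^{nd}a<1^{st}a\}$ (ordinal comparison). -}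

module Defs where

open import Level using (0ℓ)
open import Data.Nat as ℕ using (ℕ)
open import Data.Integer as ℤ using (ℤ; +_; -[1+_]; _+_; -_)
open import Data.Product using (_×_; _,_; proj₁; proj₂)
open import Data.List using (List; []; _∷_; map)
open import Data.List.Relation.Unary.All using (All)
open import Data.List.Relation.Unary.Linked using (Linked)
open import Data.List.Membership.Propositional using (_∈_)
open import Data.Sum using (_⊎_)
open import Data.Empty using (⊥)
open import Relation.Binary.Core using (Rel)
open import Relation.Binary.Definitions using (Tri; tri<; tri≈; tri>)
open import Relation.Binary.Structures using (IsStrictTotalOrder)
open import Relation.Binary.PropositionalEquality using (_≡_)

-- Ordinals in Cantor normal form, over an abstract well-ordered class E
-- of exponents (instantiated by the ordinals).
module Ordinals {E : Set} {_<_ : Rel E 0ℓ}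
                (sto : IsStrictTotalOrder _≡_ _<_) where

  open IsStrictTotalOrder sto using (compare)

  -- a CNF term  ω^e · c
  Term : Set
  Term = E × ℕ

  CNF : Set
  CNF = List Term

  IsCNF : CNF → Set
  IsCNF α = All (λ t → 0 ℕ.< proj₂ t) α × Linked (λ s t → proj₁ t < proj₁ s) α

  data _<ᴼ_ : CNF → CNF → Set where
    []<∷   : ∀ {t β} → [] <ᴼ (t ∷ β)
    exp<   : ∀ {e c α f d β} → e < f → ((e , c) ∷ α) <ᴼ ((f , d) ∷ β)
    coef<  : ∀ {e c α d β} → c ℕ.< d → ((e , c) ∷ α) <ᴼ ((e , d) ∷ β)
    tail<  : ∀ {t α β} → α <ᴼ β → (t ∷ α) <ᴼ (t ∷ β)

  _≤ᴼ_ : CNF → CNF → Set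
  α ≤ᴼ β = α <ᴼ β ⊎ α ≡ β

  exponents : CNF → List E
  exponents = map proj₁

  record ℤ∞ : Set where
    constructor ⟨_,_⟩
    field
      1st 2nd  : CNF
      1st-cnf  : IsCNF 1st
      2nd-cnf  : IsCNF 2nd
      disjoint : ∀ e → e ∈ exponents 1st → e ∈ exponents 2nd → ⊥
  open ℤ∞ public

  -- formal sums  Σ ω^ζ c_ζ , c_ζ ∈ ℤ, listed by decreasing exponent
  Formal : Set
  Formal = List (E × ℤ)

  addF : Formal → Formal → Formal
  addF [] ys = ys
  addF (x ∷ xs) = go
    where
    cons? : E → ℤ → Formal → Formal
    cons? e (+ ℕ.zero) zs = zs
    cons? e s zs = (e , s) ∷ zs

    go : Formal → Formal
    go [] = x ∷ xs
    go ((f , d) ∷ ys) with compare (proj₁ x) f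
    ... | tri< _ _ _ = (f , d) ∷ go ys
    ... | tri> _ _ _ = x ∷ addF xs ((f , d) ∷ ys)
    ... | tri≈ _ _ _ = cons? f (proj₂ x + d) (addF xs ys)

  -- the formal sum of a pair (α , β):  coefficient in β minus coefficient in α
  toFormal : CNF → CNF → Formal
  toFormal α β = addF (map (λ t → proj₁ t , - (+ proj₂ t)) α)
                      (map (λ t → proj₁ t , + proj₂ t) β)

  fromFormal : Formal → CNF × CNF
  fromFormal [] = [] , []
  fromFormal ((e , + ℕ.zero) ∷ xs) = fromFormal xs
  fromFormal ((e , + ℕ.suc n) ∷ xs) =
    proj₁ (fromFormal xs) , (e , ℕ.suc n) ∷ proj₂ (fromFormal xs)
  fromFormal ((e , -[1+ n ]) ∷ xs) =
    (e , ℕ.suc n) ∷ proj₁ (fromFormal xs) , proj₂ (fromFormal xs)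

  _⊕_ : ℤ∞ → ℤ∞ → CNF × CNF
  a ⊕ b = fromFormal (addF (toFormal (1st a) (2nd a)) (toFormal (1st b) (2nd b)))

  Pos : CNF × CNF → Set
  Pos p = proj₁ p ≤ᴼ proj₂ p

  Neg : CNF × CNF → Set
  Neg p = proj₂ p <ᴼ proj₁ p

  pair : ℤ∞ → CNF × CNF
  pair a = 1st a , 2nd a

module Submission where

-- Call a formal sum  Σ ω^ζ c_ζ  "led by sign S" when its first (largest)
-- term has a coefficient of sign S and every later exponent lies strictly
-- below the first one.  The proof transports the sign of a Surinteger
-- through three stages:
--   1. a pair (α , β) of disjoint Cantor normal forms with α < β (resp.
--      β < α) has a formal sum led by a positive (resp. negative)
--      coefficient: disjointness forces the comparison to be decided by
--      the leading exponents, and that leading term dominates the sum;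
--   2. adding two formal sums led by the same sign gives a sum led by that
--      sign, because the larger leading exponent survives, and equal
--      leading exponents add to a coefficient of the same (nonzero) sign;
--   3. reading a formal sum led by a positive (resp. negative) coefficient
--      back as a pair yields (α , β) with α < β (resp. β < α).
-- Along the way we use that addF and fromFormal never create exponents.

open import Defs
open import Level using (0ℓ)
open import Function using (_∘_)
open import Data.Product using (_×_; _,_; proj₁; proj₂)
open import Relation.Binary.Core using (Rel)
open import Relation.Binary.Structures using (IsStrictTotalOrder)
open import Relation.Binary.PropositionalEquality using (_≡_; refl; sym; cong; subst)
open import Induction.WellFounded using (WellFounded)
open import Data.Nat as ℕ using (suc)
open import Data.Integer as ℤ
  using (ℤ; +_; -[1+_]; +[1+_]; 0ℤ; Positive; Negative)
open import Data.List using (List; []; _∷_; map)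
open import Data.List.Relation.Unary.All as All using (All; []; _∷_)
open import Data.List.Relation.Unary.All.Properties using (map⁺)
open import Data.List.Relation.Unary.Linked using (Linked; [-]; _∷_)
open import Data.List.Relation.Unary.Any using (here)
open import Data.List.Membership.Propositional using (_∈_)
open import Data.Sum using (_⊎_; inj₁; inj₂)
open import Data.Empty using (⊥; ⊥-elim)
open import Relation.Nullary using (¬_)
open import Relation.Binary.Definitions using (tri<; tri≈; tri>)

Positive-+ : ∀ {c d} → Positive c → Positive d → Positive (c ℤ.+ d)
Positive-+ {+[1+ _ ]} {+[1+ _ ]} _ _ = _

Negative-+ : ∀ {c d} → Negative c → Negative d → Negative (c ℤ.+ d)
Negative-+ { -[1+ _ ]} { -[1+ _ ]} _ _ = _

¬Positive-0 : ¬ Positive 0ℤ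
¬Positive-0 ()

¬Negative-0 : ¬ Negative 0ℤ
¬Negative-0 ()

module SignClosure {E : Set} {_<_ : Rel E 0ℓ} (sto : IsStrictTotalOrder _≡_ _<_) where
  open Ordinals sto
  open IsStrictTotalOrder sto using (compare; trans)

  Below : {A : Set} → E → List (E × A) → Set
  Below e = All ((_< e) ∘ proj₁)

  Below-weaken : ∀ {A e f} {xs : List (E × A)} → e < f → Below e xs → Below f xs
  Below-weaken e<f = All.map (λ p → trans p e<f)

  data Led (S : ℤ → Set) : Formal → Set where
    led : ∀ {e c xs} → S c → Below e xs → Led S ((e , c) ∷ xs)

  PositiveF : Formal → Set
  PositiveF xs = Led Positive xs ⊎ xs ≡ []

  Decreasing : Term → Term → Set
  Decreasing s t = proj₁ t < proj₁ s

  Disjoint : CNF → CNF → Set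
  Disjoint α β = ∀ e → e ∈ exponents α → e ∈ exponents β → ⊥

  Disjoint-sym : ∀ {α β} → Disjoint α β → Disjoint β α
  Disjoint-sym dis e p q = dis e q p

  -- Exponent bookkeeping: addF and fromFormal only use exponents
  -- already present, so any property of exponents is preserved.
  module _ (Q : E → Set) where
    -- follows addF: an outer recursion on xs, and for a fixed head x of
    -- xs the inner loop (addF's local go) over ys
    addF-All : ∀ xs ys → All (Q ∘ proj₁) xs → All (Q ∘ proj₁) ys
             → All (Q ∘ proj₁) (addF xs ys)
    addF-go-All : ∀ x xs ys → All (Q ∘ proj₁) (x ∷ xs) → All (Q ∘ proj₁) ys
                → All (Q ∘ proj₁) (addF (x ∷ xs) ys)

    addF-All []       ys _   qys = qys
    addF-All (x ∷ xs) ys qxs qys = addF-go-All x xs ys qxs qys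

    addF-go-All x xs []       qxs _ = qxs
    addF-go-All x xs (y ∷ ys) qxs@(qx ∷ qxs′) (qy ∷ qys)
      with compare (proj₁ x) (proj₁ y)
    ... | tri< _ _ _ = qy ∷ addF-go-All x xs ys qxs qys
    ... | tri> _ _ _ = qx ∷ addF-All xs (y ∷ ys) qxs′ (qy ∷ qys)
    ... | tri≈ _ _ _ with proj₂ x ℤ.+ proj₂ y
    ...   | + ℕ.zero = addF-All xs ys qxs′ qys
    ...   | +[1+ _ ] = qy ∷ addF-All xs ys qxs′ qys
    ...   | -[1+ _ ] = qy ∷ addF-All xs ys qxs′ qys

    fromFormal-All : ∀ {xs} → All (Q ∘ proj₁) xs
                   → All (Q ∘ proj₁) (proj₁ (fromFormal xs))
                     × All (Q ∘ proj₁) (proj₂ (fromFormal xs))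
    fromFormal-All {[]} [] = [] , []
    fromFormal-All {(_ , + ℕ.zero) ∷ _} (_ ∷ qs) = fromFormal-All qs
    fromFormal-All {(_ , +[1+ _ ]) ∷ _} (q ∷ qs) =
      proj₁ (fromFormal-All qs) , q ∷ proj₂ (fromFormal-All qs)
    fromFormal-All {(_ , -[1+ _ ]) ∷ _} (q ∷ qs) =
      q ∷ proj₁ (fromFormal-All qs) , proj₂ (fromFormal-All qs)

  addF-identityʳ : ∀ xs → addF xs [] ≡ xs
  addF-identityʳ []      = refl
  addF-identityʳ (_ ∷ _) = refl

  addF-dominantˡ : ∀ {e c} xs {ys} → Below e ys
                 → addF ((e , c) ∷ xs) ys ≡ (e , c) ∷ addF xs ys
  addF-dominantˡ xs [] = cong (_ ∷_) (sym (addF-identityʳ xs))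
  addF-dominantˡ {e} xs {(f , _) ∷ _} (f<e ∷ _) with compare e f
  ... | tri< _ _ f≮e = ⊥-elim (f≮e f<e)
  ... | tri≈ _ _ f≮e = ⊥-elim (f≮e f<e)
  ... | tri> _ _ _   = refl

  addF-dominantʳ : ∀ {f d xs} ys → Below f xs
                 → addF xs ((f , d) ∷ ys) ≡ (f , d) ∷ addF xs ys
  addF-dominantʳ ys [] = refl
  addF-dominantʳ {f} {xs = (e , _) ∷ _} ys (e<f ∷ _) with compare e f
  ... | tri< _ _ _   = refl
  ... | tri≈ e≮f _ _ = ⊥-elim (e≮f e<f)
  ... | tri> e≮f _ _ = ⊥-elim (e≮f e<f)

  negated : CNF → Formal
  negated = map (λ t → proj₁ t , ℤ.- (+ proj₂ t))

  positive : CNF → Formal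
  positive = map (λ t → proj₁ t , + proj₂ t)

  toFormal-led⁺ : ∀ {f d α β} → Below f α → Below f β
                → Led Positive (toFormal α ((f , suc d) ∷ β))
  toFormal-led⁺ {f} {α = α} {β} bα bβ =
    subst (Led Positive) (sym (addF-dominantʳ (positive β) (map⁺ bα)))
      (led _ (addF-All (_< f) (negated α) (positive β) (map⁺ bα) (map⁺ bβ)))

  toFormal-led⁻ : ∀ {e c α β} → Below e α → Below e β
                → Led Negative (toFormal ((e , suc c) ∷ α) β)
  toFormal-led⁻ {e} {α = α} {β} bα bβ =
    subst (Led Negative) (sym (addF-dominantˡ (negated α) (map⁺ bβ)))
      (led _ (addF-All (_< e) (negated α) (positive β) (map⁺ bα) (map⁺ bβ)))

  head-dominates : ∀ {t α} → Linked Decreasing (t ∷ α) → Below (proj₁ t) α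
  head-dominates [-]     = []
  head-dominates (r ∷ l) = r ∷ Below-weaken r (head-dominates l)

  -- for disjoint CNFs γ < δ is decided by the leading exponents, so all
  -- exponents of γ lie below the leading exponent of δ
  <ᴼ-disjoint-below : ∀ {γ f d δ} → Linked Decreasing γ
                    → Disjoint γ ((f , d) ∷ δ) → γ <ᴼ ((f , d) ∷ δ) → Below f γ
  <ᴼ-disjoint-below _ _   []<∷      = []
  <ᴼ-disjoint-below l _   (exp< e<f) = e<f ∷ Below-weaken e<f (head-dominates l)
  <ᴼ-disjoint-below _ dis (coef< _)  = ⊥-elim (dis _ (here refl) (here refl))
  <ᴼ-disjoint-below _ dis (tail< _)  = ⊥-elim (dis _ (here refl) (here refl))

  self-disjoint : ∀ {α} → Disjoint α α → α ≡ []
  self-disjoint {[]}    _   = refl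
  self-disjoint {_ ∷ _} dis = ⊥-elim (dis _ (here refl) (here refl))

  pair-positive : ∀ {α β} → IsCNF α → IsCNF β → Disjoint α β → α ≤ᴼ β
                → PositiveF (toFormal α β)
  pair-positive _ _ dis (inj₂ refl) rewrite self-disjoint dis = inj₂ refl
  pair-positive {β = (_ , suc _) ∷ _} (_ , lα) (_ , lβ) dis (inj₁ α<β) =
    inj₁ (toFormal-led⁺ (<ᴼ-disjoint-below lα dis α<β) (head-dominates lβ))
  pair-positive {β = (_ , ℕ.zero) ∷ _} _ ((() ∷ _) , _) _ (inj₁ _)

  pair-negative : ∀ {α β} → IsCNF α → IsCNF β → Disjoint α β → β <ᴼ α
                → Led Negative (toFormal α β)
  pair-negative {α@((_ , suc _) ∷ _)} {β} (_ , lα) (_ , lβ) dis β<α =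
    toFormal-led⁻ (head-dominates lα)
                  (<ᴼ-disjoint-below lβ (Disjoint-sym {α} {β} dis) β<α)
  pair-negative {α = (_ , ℕ.zero) ∷ _} ((() ∷ _) , _) _ _ _

  module _ {S : ℤ → Set} (S-+ : ∀ {c d} → S c → S d → S (c ℤ.+ d))
           (¬S-0 : ¬ S 0ℤ) where
    Led-+ : ∀ {xs ys} → Led S xs → Led S ys → Led S (addF xs ys)
    Led-+ (led {e} {c} sc bx) (led {f} {d} sd by) with compare e f
    ... | tri< e<f _ _ = led sd (addF-All (_< f) _ _ (e<f ∷ Below-weaken e<f bx) by)
    ... | tri> _ _ f<e = led sc (addF-All (_< e) _ _ bx (f<e ∷ Below-weaken f<e by))
    ... | tri≈ _ refl _ with c ℤ.+ d | S-+ sc sd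
    ...   | + ℕ.zero | s0 = ⊥-elim (¬S-0 s0)
    ...   | +[1+ _ ] | s  = led s (addF-All (_< e) _ _ bx by)
    ...   | -[1+ _ ] | s  = led s (addF-All (_< e) _ _ bx by)

  PositiveF-+ : ∀ {xs ys} → PositiveF xs → PositiveF ys → PositiveF (addF xs ys)
  PositiveF-+ (inj₂ refl) pys = pys
  PositiveF-+ {xs} pxs (inj₂ refl) rewrite addF-identityʳ xs = pxs
  PositiveF-+ (inj₁ lx) (inj₁ ly) = inj₁ (Led-+ Positive-+ ¬Positive-0 lx ly)

  below-<ᴼ : ∀ {e d γ δ} → Below e δ → δ <ᴼ ((e , d) ∷ γ)
  below-<ᴼ []      = []<∷
  below-<ᴼ (p ∷ _) = exp< p

  fromFormal-positive : ∀ {xs} → PositiveF xs → Pos (fromFormal xs)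
  fromFormal-positive (inj₂ refl) = inj₂ refl
  fromFormal-positive (inj₁ (led {e} {+[1+ _ ]} _ b)) =
    inj₁ (below-<ᴼ (proj₁ (fromFormal-All (_< e) b)))

  fromFormal-negative : ∀ {xs} → Led Negative xs → Neg (fromFormal xs)
  fromFormal-negative (led {e} { -[1+ _ ]} _ b) =
    below-<ᴼ (proj₂ (fromFormal-All (_< e) b))

lemma9p17 : (E : Set) (_<_ : Rel E 0ℓ) (sto : IsStrictTotalOrder _≡_ _<_)
            → WellFounded _<_
            → let open Ordinals sto in
              (∀ (a b : ℤ∞) → Pos (pair a) → Pos (pair b) → Pos (a ⊕ b))
              × (∀ (a b : ℤ∞) → Neg (pair a) → Neg (pair b) → Neg (a ⊕ b))
lemma9p17 E _<_ sto _ =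
  (λ a b a⁺ b⁺ → fromFormal-positive
                   (PositiveF-+ (formal-positive a a⁺) (formal-positive b b⁺))) ,
  (λ a b a⁻ b⁻ → fromFormal-negative
                   (Led-+ Negative-+ ¬Negative-0 (formal-negative a a⁻) (formal-negative b b⁻)))
  where
  open Ordinals sto
  open SignClosure sto

  formal-positive : ∀ a → Pos (pair a) → PositiveF (toFormal (1st a) (2nd a))
  formal-positive a = pair-positive (1st-cnf a) (2nd-cnf a) (disjoint a)

  formal-negative : ∀ a → Neg (pair a) → Led Negative (toFormal (1st a) (2nd a))
  formal-negative a = pair-negative (1st-cnf a) (2nd-cnf a) (disjoint a)
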